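{- Let $G=(V,E)$ be an undirected graph with $m=|E|$ edges and positive integer edge weights $w$, let $N$ be a positive integer, and for each edge $e$ let $r(e)\in\{1,2,\ldots,N\}$ (e.g., chosen uniformly and independently at random). Define $w'(e) := mN\cdot w(e) + r(e)$ for every edge $e$. Then every extreme set of $G$ under edge weights $w$ is also an extreme set of $G$ under edge weights $w'$.
   Context: For edge weights $c$ and $Z\subseteq V$, $\delta_c(Z)$ is the total $c$-weight of edges with exactly one endpoint in $Z$. A nonempty set $X\subsetneq V$ is an extreme set under weights $c$ if $\delta_c(Y)>\delta_c(X)$ for every nonempty proper subset $Y\subsetneq X$. -}

module Defs where

open import Data.Nat using (ℕ; zero; suc; _+_; _*_; _<_; _≤_)
open import Data.Bool using (Bool; true; false; _xor_)
open import Data.Fin using (Fin; zero; suc)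
open import Data.Fin.Subset using (Subset; _⊂_; Nonempty)
open import Data.Vec using (lookup)
open import Data.Product using (_×_; proj₁; proj₂)

-- An undirected (multi)graph on vertex set V = Fin n with m edges,
-- edge e having endpoints (ends e).  Edge order is irrelevant.
record Graph (n m : ℕ) : Set where
  field
    ends : Fin m → Fin n × Fin n
open Graph public

∑ : (m : ℕ) → (Fin m → ℕ) → ℕ
∑ zero    f = 0
∑ (suc m) f = f zero + ∑ m (λ i → f (suc i))

crosses : ∀ {n m} → Graph n m → Subset n → Fin m → Bool
crosses G Z e = lookup Z (proj₁ (ends G e)) xor lookup Z (proj₂ (ends G e))

δ : ∀ {n m} → Graph n m → (Fin m → ℕ) → Subset n → ℕ
δ {m = m} G c Z = ∑ m (λ e → if-cross (crosses G Z e) (c e))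
  where
  if-cross : Bool → ℕ → ℕ
  if-cross true  x = x
  if-cross false _ = 0

record Extreme {n m} (G : Graph n m) (c : Fin m → ℕ) (X : Subset n) : Set where
  field
    nonempty : Nonempty X
    proper   : X ⊂ Data.Fin.Subset.⊤
    extreme  : ∀ (Y : Subset n) → Nonempty Y → Y ⊂ X → δ G c X < δ G c Y

-- Since w' = K·w + r with K = mN, every cut satisfies δ_{w'}(Z) = K·δ_w(Z) + δ_r(Z), and the
-- perturbation δ_r(Z) lies between 0 and mN = K.  So a strict inequality δ_w(X) < δ_w(Y)
-- between integers survives scaling by K and adding perturbations: K·δ_w(X) + δ_r(X) ≤ K·δ_w(Y),
-- and δ_r(Y) > 0 because Y, having positive w-cut, is crossed by an edge, which has r ≥ 1.
module Submission where

open import Defs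
open import Data.Bool using (true; false; if_then_else_)
open import Data.Nat using (ℕ; zero; suc; _+_; _*_; _≤_; _<_; z≤n; s≤s)
open import Data.Nat.Properties
open import Data.Fin using (Fin; zero; suc)
open import Data.Fin.Subset using (Subset)
open import Function using (_∘_)
open import Data.Product using (_×_; proj₁; proj₂)
open import Relation.Binary.PropositionalEquality using (_≡_; refl; sym; trans; cong; cong₂; subst; subst₂; module ≡-Reasoning)
open import Algebra.Properties.Semiring.Sum +-*-semiring
  using (sum; sum-cong-≗; ∑-distrib-+; *-distribˡ-sum)

∑≡sum : ∀ m (f : Fin m → ℕ) → ∑ m f ≡ sum f
∑≡sum zero    f = refl
∑≡sum (suc m) f = cong (f zero +_) (∑≡sum m (f ∘ suc))

∑-cong : ∀ m {f g : Fin m → ℕ} → (∀ e → f e ≡ g e) → ∑ m f ≡ ∑ m g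
∑-cong m {f} {g} f≗g = trans (∑≡sum m f) (trans (sum-cong-≗ f≗g) (sym (∑≡sum m g)))

∑-linear : ∀ m k (f g : Fin m → ℕ) → ∑ m (λ e → k * f e + g e) ≡ k * ∑ m f + ∑ m g
∑-linear m k f g = begin
  ∑ m (λ e → k * f e + g e)     ≡⟨ ∑≡sum m _ ⟩
  sum (λ e → k * f e + g e)     ≡⟨ ∑-distrib-+ (λ e → k * f e) g ⟩
  sum (λ e → k * f e) + sum g   ≡⟨ cong (_+ sum g) (*-distribˡ-sum k f) ⟨
  k * sum f + sum g             ≡⟨ cong₂ (λ x y → k * x + y) (∑≡sum m f) (∑≡sum m g) ⟨
  k * ∑ m f + ∑ m g             ∎
  where open ≡-Reasoning

∑-bounded : ∀ m b (f : Fin m → ℕ) → (∀ e → f e ≤ b) → ∑ m f ≤ m * b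
∑-bounded zero    b f f≤b = z≤n
∑-bounded (suc m) b f f≤b = +-mono-≤ (f≤b zero) (∑-bounded m b (λ e → f (suc e)) (λ e → f≤b (suc e)))

∑-positive : ∀ m (f g : Fin m → ℕ) → (∀ e → 0 < f e → 0 < g e) → 0 < ∑ m f → 0 < ∑ m g
∑-positive (suc m) f g f⇒g 0<∑f with f zero in f₀≡
... | suc _ = ≤-trans (f⇒g zero (≤-trans (s≤s z≤n) (≤-reflexive (sym f₀≡)))) (m≤m+n _ _)
... | zero  = ≤-trans (∑-positive m _ _ (λ e → f⇒g (suc e)) 0<∑f) (m≤n+m _ _)

a<b⇒k*a+p<k*b+q : ∀ k {a b p q} → a < b → p ≤ k → 0 < q → k * a + p < k * b + q
a<b⇒k*a+p<k*b+q k {a} {b} {p} {q} a<b p≤k 0<q = begin-strict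
  k * a + p   ≤⟨ +-monoʳ-≤ (k * a) p≤k ⟩
  k * a + k   ≡⟨ +-comm (k * a) k ⟩
  k + k * a   ≡⟨ *-suc k a ⟨
  k * suc a   ≤⟨ *-monoʳ-≤ k a<b ⟩
  k * b       <⟨ m<m+n (k * b) 0<q ⟩
  k * b + q   ∎
  where open ≤-Reasoning

module _ {n m : ℕ} (G : Graph n m) where

  cut-weight : (Fin m → ℕ) → Subset n → Fin m → ℕ
  cut-weight c Z e = if crosses G Z e then c e else 0

  mutual
    δ≡∑cut-weight : ∀ c Z → δ G c Z ≡ ∑ m (cut-weight c Z)
    δ≡∑cut-weight c Z = ∑-cong m (δ-summand≡cut-weight c Z)

    -- δ's summand lives in its where-block and cannot be named, so the left-hand side is
    -- left to be inferred from the use above.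
    δ-summand≡cut-weight : ∀ c Z e → _ ≡ cut-weight c Z e
    δ-summand≡cut-weight c Z e with crosses G Z e
    ... | true  = refl
    ... | false = refl

  δ-linear : ∀ k c d Z → δ G (λ e → k * c e + d e) Z ≡ k * δ G c Z + δ G d Z
  δ-linear k c d Z = begin
    δ G (λ e → k * c e + d e) Z                            ≡⟨ δ≡∑cut-weight _ Z ⟩
    ∑ m (cut-weight (λ e → k * c e + d e) Z)               ≡⟨ ∑-cong m summand ⟩
    ∑ m (λ e → k * cut-weight c Z e + cut-weight d Z e)    ≡⟨ ∑-linear m k _ _ ⟩
    k * ∑ m (cut-weight c Z) + ∑ m (cut-weight d Z)        ≡⟨ cong₂ (λ x y → k * x + y)
                                                                (δ≡∑cut-weight c Z) (δ≡∑cut-weight d Z) ⟨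
    k * δ G c Z + δ G d Z                                  ∎
    where
    open ≡-Reasoning
    summand : ∀ e → cut-weight (λ e → k * c e + d e) Z e ≡ k * cut-weight c Z e + cut-weight d Z e
    summand e with crosses G Z e
    ... | true  = refl
    ... | false = sym (trans (+-identityʳ (k * 0)) (*-zeroʳ k))

  δ-bounded : ∀ b c Z → (∀ e → c e ≤ b) → δ G c Z ≤ m * b
  δ-bounded b c Z c≤b = subst (_≤ m * b) (sym (δ≡∑cut-weight c Z)) (∑-bounded m b _ summand)
    where
    summand : ∀ e → cut-weight c Z e ≤ b
    summand e with crosses G Z e
    ... | true  = c≤b e
    ... | false = z≤n

  δ-positive : ∀ c d Z → (∀ e → 0 < c e → 0 < d e) → 0 < δ G c Z → 0 < δ G d Z
  δ-positive c d Z c⇒d 0<δc = subst (0 <_) (sym (δ≡∑cut-weight d Z))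
    (∑-positive m _ _ summand (subst (0 <_) (δ≡∑cut-weight c Z) 0<δc))
    where
    summand : ∀ e → 0 < cut-weight c Z e → 0 < cut-weight d Z e
    summand e with crosses G Z e
    ... | true  = c⇒d e
    ... | false = λ ()

  extreme-transfer : ∀ c d X → (∀ Y → δ G c X < δ G c Y → δ G d X < δ G d Y)
                   → Extreme G c X → Extreme G d X
  extreme-transfer c d X c<⇒d< ext = record
    { nonempty = nonempty
    ; proper   = proper
    ; extreme  = λ Y ne Y⊂X → c<⇒d< Y (extreme Y ne Y⊂X)
    }
    where open Extreme ext

  perturbation-preserves-δ-< : ∀ N w r → (∀ e → 1 ≤ r e × r e ≤ N) → ∀ X Y
    → δ G w X < δ G w Y → δ G (λ e → m * N * w e + r e) X < δ G (λ e → m * N * w e + r e) Y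
  perturbation-preserves-δ-< N w r r∈[1,N] X Y δwX<δwY =
    subst₂ _<_ (sym (δ-linear (m * N) w r X)) (sym (δ-linear (m * N) w r Y))
      (a<b⇒k*a+p<k*b+q (m * N) δwX<δwY
        (δ-bounded N r X (proj₂ ∘ r∈[1,N]))
        (δ-positive w r Y (λ e _ → proj₁ (r∈[1,N] e)) (≤-trans (s≤s z≤n) δwX<δwY)))

lemma2p5 : ∀ {n m : ℕ} (G : Graph n m) (w : Fin m → ℕ) (N : ℕ) (r : Fin m → ℕ)
           → (∀ e → 1 ≤ w e) → 1 ≤ N → (∀ e → 1 ≤ r e × r e ≤ N)
           → (X : Subset n) → Extreme G w X
           → Extreme G (λ e → m * N * w e + r e) X
lemma2p5 G w N r _ _ r∈[1,N] X =
  extreme-transfer G w _ X (perturbation-preserves-δ-< G N w r r∈[1,N] X)
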